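{- Let $d\ge1$, $s=\lfloor d/2\rfloor+1$ and $D=(s-1)(d+1)+1$. Let $(p_1,p_2,\dots,p_{2D+1})$ be an orientation-homogeneous sequence of $2D+1$ points in $\mathbb{R}^d$, and let $Q=\{p_2,p_4,\dots,p_{2D}\}$ and $R=\{p_1,p_3,\dots,p_{2D+1}\}$. Let $x$ be any point for which there is a partition of $Q$ into $s$ pairwise disjoint subsets $Q_1,\dots,Q_s$ with $x\in\bigcap_{j=1}^s\operatorname{conv}Q_j$. Then $x\in\operatorname{conv}R$.
   Context: For points $q_0,\dots,q_d\in\mathbb{R}^d$, their orientation is $\operatorname{orient}(q_0,\dots,q_d)=\operatorname{sgn}\det\begin{bmatrix} q_0&\cdots&q_d\\1&\cdots&1\end{bmatrix}$. A sequence $(p_1,\dots,p_n)$ of points in $\mathbb{R}^d$ is orientation-homogeneous if all values $\operatorname{orient}(p_{j_0},\dots,p_{j_d})$ with $j_0<\dots<j_d$ are equal and nonzero. (By Tverberg's theorem, a set of $D$ points in $\mathbb{R}^d$ always admits such a partition into $s$ parts with intersecting convex hulls.) -}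

module Defs where

open import Level using (Level; _⊔_)
open import Data.Nat as ℕ using (ℕ; zero; suc)
open import Data.Fin as Fin using (Fin; zero; suc; punchIn)
open import Data.Product using (Σ; ∃; _×_; _,_)
open import Data.Sum using (_⊎_)
open import Relation.Nullary using (¬_)
open import Algebra.Bundles using (CommutativeRing)
open import Relation.Binary.Structures using (IsStrictTotalOrder)

record OrderedField (c ℓ ℓ' : Level) : Set (Level.suc (c ⊔ ℓ ⊔ ℓ')) where
  field
    commutativeRing : CommutativeRing c ℓ
  open CommutativeRing commutativeRing public
  infix 4 _<_
  field
    _<_                : Carrier → Carrier → Set ℓ'
    isStrictTotalOrder : IsStrictTotalOrder _≈_ _<_
    +-monoˡ-<          : ∀ {x y} z → x < y → x + z < y + z
    *-pos              : ∀ {x y} → 0# < x → 0# < y → 0# < x * y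
    1≉0                : ¬ (1# ≈ 0#)
    inverse            : ∀ x → ¬ (x ≈ 0#) → Σ Carrier (λ y → x * y ≈ 1#)

  infix 4 _≤_
  _≤_ : Carrier → Carrier → Set (ℓ ⊔ ℓ')
  x ≤ y = x < y ⊎ x ≈ y

module _ {c ℓ ℓ'} (F : OrderedField c ℓ ℓ') where
  open OrderedField F using (Carrier; _≈_; _+_; _*_; -_; 0#; 1#; _<_; _≤_)

  Point : ℕ → Set c
  Point d = Fin d → Carrier

  ∑ : ∀ {n} → (Fin n → Carrier) → Carrier
  ∑ {zero}  f = 0#
  ∑ {suc n} f = f zero + ∑ (λ i → f (suc i))

  altSign : ℕ → Carrier
  altSign zero    = 1#
  altSign (suc k) = - altSign k

  -- determinant by Laplace expansion along the first row;
  -- A i j is the entry in row i, column j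
  det : ∀ {n} → (Fin n → Fin n → Carrier) → Carrier
  det {zero}  A = 1#
  det {suc n} A =
    ∑ (λ j → altSign (Fin.toℕ j) * (A zero j * det (λ i k → A (suc i) (punchIn j k))))

  appendLast : ∀ {d} → (Fin d → Carrier) → Carrier → Fin (suc d) → Carrier
  appendLast {zero}  v a zero    = a
  appendLast {suc d} v a zero    = v zero
  appendLast {suc d} v a (suc i) = appendLast (λ k → v (suc k)) a i

  orientMatrix : ∀ {d} → (Fin (suc d) → Point d) → Fin (suc d) → Fin (suc d) → Carrier
  orientMatrix q i j = appendLast (q j) 1# i

  StrictlyIncreasing : ∀ {m n} → (Fin m → Fin n) → Set
  StrictlyIncreasing j = ∀ a b → a Fin.< b → j a Fin.< j b

  OrientationHomogeneous : ∀ {d n} → (Fin n → Point d) → Set ℓ'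
  OrientationHomogeneous {d} {n} p =
      (∀ (j : Fin (suc d) → Fin n) → StrictlyIncreasing j →
         0# < det (orientMatrix (λ a → p (j a))))
    ⊎ (∀ (j : Fin (suc d) → Fin n) → StrictlyIncreasing j →
         det (orientMatrix (λ a → p (j a))) < 0#)

  InConv : ∀ {d n} → (Fin n → Point d) → (Fin n → Set) → Point d → Set (c ⊔ ℓ ⊔ ℓ')
  InConv {d} {n} p S x =
    Σ (Fin n → Carrier) λ w →
        (∀ i → 0# ≤ w i)
      × (∀ i → ¬ S i → w i ≈ 0#)
      × (∑ w ≈ 1#)
      × (∀ k → ∑ (λ i → w i * p i k) ≈ x k)

-- If x ∉ conv R, Farkas' lemma gives an affine function h with h ≤ 0 on R and h(x) > 0.  As x lies
-- in the hull of every colour class, each class contains an odd-indexed point with h > 0.  Taking these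
-- s points in order, each preceded by the even point just before it, and finishing with the last (even)
-- point gives 2s + 1 ≥ d + 2 indices along which h alternates: ≤ 0, > 0, ≤ 0, …  For d + 2 such points
-- q₀, …, q_{d+1}, the matrix with first row h(q_t) over the columns (q_t, 1) is singular, since that row
-- is a combination of the others; but expanding along it gives ∑ (−1)ᵗ h(q_t) det(…q_t omitted…), whose
-- terms all have one sign (the orientations agree) and one of which is nonzero.
module Submission where

open import Algebra.Bundles using (CommutativeRing)
open import Algebra.Solver.Ring.AlmostCommutativeRing using (fromCommutativeRing; _-Raw-AlmostCommutative⟶_)
open import Data.Fin.Base as Fin using (Fin; zero; suc; toℕ; punchIn)
open import Data.Fin.Properties
  using (all?; any?; ¬∀⟶∃¬; toℕ<n; toℕ-fromℕ<; toℕ-injective; toℕ-inject≤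
        ; punchIn-injective; punchInᵢ≢i)
  renaming (_≟_ to _≟ᶠ_)
open import Data.List.Base using (allFin)
open import Data.List.Extrema.Nat using (argmin; f[argmin]≤f[xs])
open import Data.List.Membership.Propositional.Properties using (∈-allFin)
import Data.List.Relation.Unary.All as All
open import Data.Maybe.Base using (map)
open import Data.Nat.Base as ℕ using (ℕ; zero; suc; z≤n; s≤s; _%_; _/_)
open import Data.Nat.DivMod using (m*n%n≡0; m%n<n; m≡m%n+[m/n]*n)
import Data.Nat.Properties as ℕ
open import Data.Product.Base using (Σ; ∃; _×_; _,_; proj₁; proj₂)
open import Data.Sum.Base as Sum using (_⊎_; inj₁; inj₂)
open import Data.Vec.Functional using (Vector; _∷_)
open import Function.Definitions using (Injective)
open import Level using (Level; _⊔_)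
open import Relation.Binary.Consequences using (dec⇒weaklyDec)
open import Relation.Binary.Core using (_Preserves_⟶_)
open import Relation.Binary.Definitions using (tri<; tri≈; tri>)
open import Relation.Binary.PropositionalEquality as ≡ using (_≡_)
open import Relation.Binary.Structures using (IsStrictTotalOrder)
open import Relation.Nullary using (¬_; Dec; yes; no; contradiction)
open import Relation.Nullary.Decidable using (_×-dec_)
open import Relation.Unary using (Decidable)

open import Defs

-- With integer coefficients, whose equality is decidable, the standard ring solver proves
-- identities in any commutative ring.
module IntegerCoefficients {c ℓ} (R : CommutativeRing c ℓ) where
  open import Data.Integer.Base as ℤ using (ℤ; +_; -[1+_]; _⊖_; sign; ∣_∣; _◃_)
  import Data.Integer.Properties as ℤ
  open import Data.Sign.Base as Sign using (Sign)
  open CommutativeRing R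
  open import Algebra.Properties.Ring ring
    using (-‿involutive; -0#≈0#; -1*x≈-x; -‿+-comm)
  open import Algebra.Properties.CommutativeSemigroup +-commutativeSemigroup
    using (interchange)
  open import Algebra.Properties.CommutativeSemigroup *-commutativeSemigroup
    using () renaming (interchange to *-interchange)
  open import Algebra.Properties.Semiring.Mult semiring
    using (×-homo-+; ×1-homo-*) renaming (_×_ to _×ₙ_)
  open import Relation.Binary.Reasoning.Setoid setoid

  ⟦_⟧ : ℤ → Carrier
  ⟦ + n ⟧      = n ×ₙ 1#
  ⟦ -[1+ n ] ⟧ = - (suc n ×ₙ 1#)

  ⟦⊖⟧ : ∀ m n → ⟦ m ⊖ n ⟧ ≈ m ×ₙ 1# - n ×ₙ 1#
  ⟦⊖⟧ m       zero    = sym (trans (+-congˡ -0#≈0#) (+-identityʳ _))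
  ⟦⊖⟧ zero    (suc n) = sym (+-identityˡ _)
  ⟦⊖⟧ (suc m) (suc n) = begin
    ⟦ suc m ⊖ suc n ⟧                   ≡⟨ ≡.cong ⟦_⟧ (ℤ.[1+m]⊖[1+n]≡m⊖n m n) ⟩
    ⟦ m ⊖ n ⟧                           ≈⟨ ⟦⊖⟧ m n ⟩
    m ×ₙ 1# - n ×ₙ 1#                   ≈⟨ +-identityˡ _ ⟨
    0# + (m ×ₙ 1# - n ×ₙ 1#)            ≈⟨ +-congʳ (-‿inverseʳ 1#) ⟨
    (1# - 1#) + (m ×ₙ 1# - n ×ₙ 1#)     ≈⟨ interchange _ _ _ _ ⟩
    (1# + m ×ₙ 1#) + (- 1# - n ×ₙ 1#)   ≈⟨ +-congˡ (-‿+-comm 1# _) ⟩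
    (1# + m ×ₙ 1#) - (1# + n ×ₙ 1#)     ∎

  ⟦+⟧ : ∀ i j → ⟦ i ℤ.+ j ⟧ ≈ ⟦ i ⟧ + ⟦ j ⟧
  ⟦+⟧ (+ m)    (+ n)    = ×-homo-+ 1# m n
  ⟦+⟧ (+ m)    -[1+ n ] = ⟦⊖⟧ m (suc n)
  ⟦+⟧ -[1+ m ] (+ n)    = trans (⟦⊖⟧ n (suc m)) (+-comm _ _)
  ⟦+⟧ -[1+ m ] -[1+ n ] = begin
    - (suc (suc (m ℕ.+ n)) ×ₙ 1#)       ≡⟨ ≡.cong (λ k → - (suc k ×ₙ 1#)) (ℕ.+-suc m n) ⟨
    - ((suc m ℕ.+ suc n) ×ₙ 1#)         ≈⟨ -‿cong (×-homo-+ 1# (suc m) (suc n)) ⟩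
    - (suc m ×ₙ 1# + suc n ×ₙ 1#)       ≈⟨ -‿+-comm _ _ ⟨
    - (suc m ×ₙ 1#) + - (suc n ×ₙ 1#)   ∎

  ⟦-⟧ : ∀ i → ⟦ ℤ.- i ⟧ ≈ - ⟦ i ⟧
  ⟦-⟧ (+ zero)  = sym -0#≈0#
  ⟦-⟧ (+ suc n) = refl
  ⟦-⟧ -[1+ n ]  = sym (-‿involutive _)

  ⟦sign⟧ : Sign → Carrier
  ⟦sign⟧ Sign.+ = 1#
  ⟦sign⟧ Sign.- = - 1#

  ⟦◃⟧ : ∀ s n → ⟦ s ◃ n ⟧ ≈ ⟦sign⟧ s * n ×ₙ 1#
  ⟦◃⟧ s       zero    = sym (zeroʳ _)
  ⟦◃⟧ Sign.+ (suc n) = sym (*-identityˡ _)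
  ⟦◃⟧ Sign.- (suc n) = sym (-1*x≈-x _)

  sign◃∣∣ : ∀ i → ⟦ i ⟧ ≈ ⟦sign⟧ (sign i) * ∣ i ∣ ×ₙ 1#
  sign◃∣∣ (+ n)    = sym (*-identityˡ _)
  sign◃∣∣ -[1+ n ] = sym (-1*x≈-x _)

  ⟦sign*⟧ : ∀ s t → ⟦sign⟧ (s Sign.* t) ≈ ⟦sign⟧ s * ⟦sign⟧ t
  ⟦sign*⟧ Sign.+ t      = sym (*-identityˡ _)
  ⟦sign*⟧ Sign.- Sign.+ = sym (*-identityʳ _)
  ⟦sign*⟧ Sign.- Sign.- = sym (trans (-1*x≈-x _) (-‿involutive _))

  ⟦*⟧ : ∀ i j → ⟦ i ℤ.* j ⟧ ≈ ⟦ i ⟧ * ⟦ j ⟧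
  ⟦*⟧ i j = begin
    ⟦ sign i Sign.* sign j ◃ ∣ i ∣ ℕ.* ∣ j ∣ ⟧
      ≈⟨ ⟦◃⟧ (sign i Sign.* sign j) (∣ i ∣ ℕ.* ∣ j ∣) ⟩
    ⟦sign⟧ (sign i Sign.* sign j) * (∣ i ∣ ℕ.* ∣ j ∣) ×ₙ 1#
      ≈⟨ *-cong (⟦sign*⟧ (sign i) (sign j)) (×1-homo-* ∣ i ∣ ∣ j ∣) ⟩
    (⟦sign⟧ (sign i) * ⟦sign⟧ (sign j)) * (∣ i ∣ ×ₙ 1# * ∣ j ∣ ×ₙ 1#)
      ≈⟨ *-interchange _ _ _ _ ⟩
    (⟦sign⟧ (sign i) * ∣ i ∣ ×ₙ 1#) * (⟦sign⟧ (sign j) * ∣ j ∣ ×ₙ 1#)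
      ≈⟨ *-cong (sign◃∣∣ i) (sign◃∣∣ j) ⟨
    ⟦ i ⟧ * ⟦ j ⟧ ∎

  ℤ⟶R : ℤ.+-*-rawRing -Raw-AlmostCommutative⟶ fromCommutativeRing R
  ℤ⟶R = record
    { ⟦_⟧ = ⟦_⟧ ; +-homo = ⟦+⟧ ; *-homo = ⟦*⟧ ; -‿homo = ⟦-⟧
    ; 0-homo = refl ; 1-homo = +-identityʳ 1# }

  open import Algebra.Solver.Ring ℤ.+-*-rawRing (fromCommutativeRing R) ℤ⟶R
    (λ i j → map (λ i≡j → reflexive (≡.cong ⟦_⟧ i≡j)) (dec⇒weaklyDec ℤ._≟_ i j)) public
    using (solve; _:=_; _:+_; _:*_; :-_; _:-_)

-- alternating chains

Even Odd : ℕ → Set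
Even m = m % 2 ≡ 0
Odd  m = m % 2 ≡ 1

even⇒¬odd : ∀ {m} → Even m → ¬ Odd m
even⇒¬odd m%2≡0 m%2≡1 with ≡.trans (≡.sym m%2≡0) m%2≡1
... | ()

odd⇒suc-even : ∀ m → Odd m → Even (suc m)
odd⇒suc-even (suc zero)    _   = ≡.refl
odd⇒suc-even (suc (suc m)) odd = odd⇒suc-even m odd

odd⇒even-pred : ∀ m → Odd m → ∃ λ k → suc k ≡ m × Even k
odd⇒even-pred (suc zero)    _   = 0 , ≡.refl , ≡.refl
odd⇒even-pred (suc (suc m)) odd with odd⇒even-pred m odd
... | k , ≡.refl , even = suc (suc k) , ≡.refl , even

odd⇒pos : ∀ m → Odd m → 0 ℕ.< m
odd⇒pos (suc m) _ = s≤s z≤n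

double : ℕ → ℕ
double zero    = zero
double (suc m) = suc (suc (double m))

∷-increasing : ∀ {k n} (a : Fin n) (f : Fin (suc k) → Fin n) → a Fin.< f zero →
               f Preserves Fin._<_ ⟶ Fin._<_ → (a ∷ f) Preserves Fin._<_ ⟶ Fin._<_
∷-increasing a f a<f₀ f↑ {zero}  {suc zero}    _         = a<f₀
∷-increasing a f a<f₀ f↑ {zero}  {suc (suc j)} _         = ℕ.<-trans a<f₀ (f↑ {zero} {suc j} (s≤s z≤n))
∷-increasing a f a<f₀ f↑ {suc i} {suc j}       (s≤s i<j) = f↑ i<j

SignPattern : ∀ {q n} (Neg Pos : Fin n → Set q) → ℕ → Fin n → Set q
SignPattern Neg Pos zero          = Neg
SignPattern Neg Pos (suc zero)    = Pos
SignPattern Neg Pos (suc (suc t)) = SignPattern Neg Pos t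

even-last-index : ∀ N → ∃ λ (last : Fin (2 ℕ.* N ℕ.+ 1)) →
                  Even (toℕ last) × ∀ (i : Fin (2 ℕ.* N ℕ.+ 1)) → toℕ i ℕ.≤ toℕ last
even-last-index N =
  last ,
  ≡.subst Even (≡.sym last≡2N) (≡.subst (λ k → k % 2 ≡ 0) (ℕ.*-comm N 2) (m*n%n≡0 N 2)) ,
  λ i → ≡.subst (toℕ i ℕ.≤_) (≡.sym last≡2N)
                (ℕ.m<1+n⇒m≤n (≡.subst (toℕ i ℕ.<_) (ℕ.+-comm (2 ℕ.* N) 1) (toℕ<n i)))
  where
  2N<2N+1 = ℕ.m<m+n (2 ℕ.* N) (s≤s z≤n)
  last = Fin.fromℕ< 2N<2N+1
  last≡2N = toℕ-fromℕ< 2N<2N+1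

module AlternatingChain {q} {n : ℕ} (Neg Pos : Fin n → Set q)
  (even⇒Neg : ∀ i → Even (toℕ i) → Neg i)
  (last : Fin n) (last-even : Even (toℕ last)) (≤last : ∀ (i : Fin n) → toℕ i ℕ.≤ toℕ last) where

  Chain : ℕ → ℕ → Set q
  Chain k b = ∃ λ (ι : Fin (suc (double k)) → Fin n) →
    ι Preserves Fin._<_ ⟶ Fin._<_ × b ℕ.≤ toℕ (ι zero) × (∀ t → SignPattern Neg Pos (toℕ t) (ι t))

  -- With o sorted as o₀ < o₁ < ⋯, the chain is o₀ − 1, o₀, o₁ − 1, o₁, …, last.
  chain : ∀ k (o : Fin k → Fin n) → Injective _≡_ _≡_ o →
          (∀ j → Odd (toℕ (o j))) → (∀ j → Pos (o j)) →
          ∀ b → b ℕ.≤ toℕ last → (∀ j → b ℕ.< toℕ (o j)) → Chain k b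
  chain zero    o _     _   _   b b≤last _   =
    (λ _ → last) , (λ { {zero} {zero} () }) , b≤last , λ { zero → even⇒Neg last last-even }
  chain (suc k) o o-inj odd pos b b≤last b<o =
    (e ∷ o₀ ∷ ι) , ∷-increasing e (o₀ ∷ ι) e<o₀ (∷-increasing o₀ ι o₀<ι₀ ι↑) , b≤e , signs
    where
    m = argmin (λ j → toℕ (o j)) zero (allFin (suc k))
    o₀ = o m
    rest : Fin k → Fin n
    rest j = o (punchIn m j)

    o₀<rest : ∀ j → toℕ o₀ ℕ.< toℕ (rest j)
    o₀<rest j = ℕ.≤∧≢⇒<
      (All.lookup (f[argmin]≤f[xs] {f = λ j → toℕ (o j)} zero (allFin (suc k))) (∈-allFin (punchIn m j)))
      (λ eq → punchInᵢ≢i m j (o-inj (toℕ-injective (≡.sym eq))))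
    o₀<last : toℕ o₀ ℕ.< toℕ last
    o₀<last = ℕ.≤∧≢⇒< (≤last o₀) (λ eq → even⇒¬odd {toℕ last} last-even (≡.subst Odd eq (odd m)))
    1+o₀<rest : ∀ j → suc (toℕ o₀) ℕ.< toℕ (rest j)
    1+o₀<rest j = ℕ.≤∧≢⇒< (o₀<rest j) (λ eq → even⇒¬odd {toℕ (rest j)}
                                                (≡.subst Even eq (odd⇒suc-even (toℕ o₀) (odd m))) (odd (punchIn m j)))

    rec = chain k rest (λ eq → punchIn-injective m _ _ (o-inj eq))
                (λ j → odd (punchIn m j)) (λ j → pos (punchIn m j)) (suc (toℕ o₀)) o₀<last 1+o₀<rest
    ι = proj₁ rec
    ι↑ = proj₁ (proj₂ rec)
    o₀<ι₀ = proj₁ (proj₂ (proj₂ rec))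

    pred = odd⇒even-pred (toℕ o₀) (odd m)
    p = proj₁ pred
    1+p≡o₀ = proj₁ (proj₂ pred)
    p<o₀ : p ℕ.< toℕ o₀
    p<o₀ = ℕ.≤-reflexive 1+p≡o₀
    e : Fin n
    e = Fin.fromℕ< (ℕ.<-trans p<o₀ (toℕ<n o₀))
    e≡p : toℕ e ≡ p
    e≡p = toℕ-fromℕ< _
    e<o₀ : e Fin.< o₀
    e<o₀ = ≡.subst (ℕ._< toℕ o₀) (≡.sym e≡p) p<o₀
    b≤e : b ℕ.≤ toℕ e
    b≤e = ≡.subst (b ℕ.≤_) (≡.sym e≡p) (ℕ.s≤s⁻¹ (≡.subst (b ℕ.<_) (≡.sym 1+p≡o₀) (b<o m)))

    signs : ∀ t → SignPattern Neg Pos (toℕ t) ((e ∷ o₀ ∷ ι) t)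
    signs zero          = even⇒Neg e (≡.subst Even (≡.sym e≡p) (proj₂ (proj₂ pred)))
    signs (suc zero)    = pos m
    signs (suc (suc t)) = proj₂ (proj₂ (proj₂ rec)) t

  coloured-chain : ∀ {s} (col : Fin n → Fin s) →
                   (∀ j → ∃ λ i → (Odd (toℕ i) × col i ≡ j) × Pos i) → Chain s 0
  coloured-chain {s} col witness = chain s o o-inj odd (λ j → proj₂ (proj₂ (witness j)))
                                         0 z≤n (λ j → odd⇒pos (toℕ (o j)) (odd j))
    where
    o = λ j → proj₁ (witness j)
    odd = λ j → proj₁ (proj₁ (proj₂ (witness j)))
    col∘o≡id = λ j → proj₂ (proj₁ (proj₂ (witness j)))
    o-inj : Injective _≡_ _≡_ o
    o-inj {a} {b} oa≡ob = ≡.trans (≡.sym (col∘o≡id a)) (≡.trans (≡.cong col oa≡ob) (col∘o≡id b))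

module _ {c ℓ ℓ'} (F : OrderedField c ℓ ℓ') where
  open OrderedField F hiding (zero)
  open IntegerCoefficients commutativeRing
  open import Algebra.Properties.Ring ring using (-‿involutive; -0#≈0#; -1*x≈-x; -‿+-comm; -‿distribˡ-*)
  open import Algebra.Properties.Semiring.Sum semiring
    using (sum; sum-cong-≋; ∑-distrib-+; *-distribˡ-sum; *-distribʳ-sum; sum-replicate-zero)
  open IsStrictTotalOrder isStrictTotalOrder
    using (compare; irrefl; asym; <-respˡ-≈; <-respʳ-≈; _≟_; _<?_) renaming (trans to <-trans)
  import Relation.Binary.Construct.StrictToNonStrict _≈_ _<_ as NonStrict
  open import Relation.Binary.Reasoning.Setoid setoid

  ≤-respˡ-≈ : ∀ {x y z} → y ≈ x → y ≤ z → x ≤ z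
  ≤-respˡ-≈ = NonStrict.≤-respˡ-≈ sym trans <-respˡ-≈

  ≤-respʳ-≈ : ∀ {x y z} → y ≈ z → x ≤ y → x ≤ z
  ≤-respʳ-≈ = NonStrict.≤-respʳ-≈ trans <-respʳ-≈

  ≮⇒≥ : ∀ {x y} → ¬ (x < y) → y ≤ x
  ≮⇒≥ x≮y with compare _ _
  ... | tri< x<y _ _ = contradiction x<y x≮y
  ... | tri≈ _ x≈y _ = inj₂ (sym x≈y)
  ... | tri> _ _ y<x = inj₁ y<x

  ≤⇒≯ : ∀ {x y} → x ≤ y → ¬ (y < x)
  ≤⇒≯ (inj₁ x<y) = asym x<y
  ≤⇒≯ (inj₂ x≈y) = irrefl (sym x≈y)

  +-monoʳ-< : ∀ {x y} z → x < y → z + x < z + y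
  +-monoʳ-< {x} {y} z x<y = <-respˡ-≈ (+-comm x z) (<-respʳ-≈ (+-comm y z) (+-monoˡ-< z x<y))

  +-mono-≤-< : ∀ {a b x y} → a ≤ b → x < y → a + x < b + y
  +-mono-≤-< {x = x} (inj₁ a<b) x<y = <-trans (+-monoˡ-< x a<b) (+-monoʳ-< _ x<y)
  +-mono-≤-< {x = x} (inj₂ a≈b) x<y = <-respˡ-≈ (+-congʳ (sym a≈b)) (+-monoʳ-< _ x<y)

  +-mono-<-≤ : ∀ {a b x y} → a < b → x ≤ y → a + x < b + y
  +-mono-<-≤ a<b x≤y = <-respˡ-≈ (+-comm _ _) (<-respʳ-≈ (+-comm _ _) (+-mono-≤-< x≤y a<b))

  +-mono-≤ : ∀ {a b x y} → a ≤ b → x ≤ y → a + x ≤ b + y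
  +-mono-≤ a≤b        (inj₁ x<y) = inj₁ (+-mono-≤-< a≤b x<y)
  +-mono-≤ (inj₁ a<b) (inj₂ x≈y) = inj₁ (+-mono-<-≤ a<b (inj₂ x≈y))
  +-mono-≤ (inj₂ a≈b) (inj₂ x≈y) = inj₂ (+-cong a≈b x≈y)

  neg-antimono-< : ∀ {x y} → x < y → - y < - x
  neg-antimono-< {x} {y} x<y = <-respˡ-≈ (sym (solve 2 (λ x y → :- y := x :+ (:- x :- y)) refl x y))
    (<-respʳ-≈ (solve 2 (λ x y → y :+ (:- x :- y) := :- x) refl x y) (+-monoˡ-< (- x - y) x<y))

  neg⇒-pos : ∀ {x} → x < 0# → 0# < - x
  neg⇒-pos x<0 = <-respˡ-≈ -0#≈0# (neg-antimono-< x<0)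

  pos⇒-neg : ∀ {x} → 0# < x → - x < 0#
  pos⇒-neg 0<x = <-respʳ-≈ -0#≈0# (neg-antimono-< 0<x)

  -pos⇒neg : ∀ {x} → 0# < - x → x < 0#
  -pos⇒neg 0<-x = <-respˡ-≈ (-‿involutive _) (pos⇒-neg 0<-x)

  x≈-x⇒x≈0 : ∀ {x} → x ≈ - x → x ≈ 0#
  x≈-x⇒x≈0 {x} x≈-x with compare x 0#
  ... | tri< x<0 _ _ = contradiction (<-respʳ-≈ (sym x≈-x) (neg⇒-pos x<0)) (asym x<0)
  ... | tri≈ _ x≈0 _ = x≈0
  ... | tri> _ _ 0<x = contradiction (<-respˡ-≈ (sym x≈-x) (pos⇒-neg 0<x)) (asym 0<x)

  0<1 : 0# < 1#
  0<1 with compare 0# 1#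
  ... | tri< 0<1 _ _ = 0<1
  ... | tri≈ _ 0≈1 _ = contradiction (sym 0≈1) 1≉0
  ... | tri> _ _ 1<0 = contradiction (<-respʳ-≈ -1*-1≈1 (*-pos (neg⇒-pos 1<0) (neg⇒-pos 1<0))) (asym 1<0)
    where -1*-1≈1 = trans (-1*x≈-x (- 1#)) (-‿involutive 1#)

  *-neg-pos : ∀ {x y} → x < 0# → 0# < y → x * y < 0#
  *-neg-pos {x} {y} x<0 0<y = -pos⇒neg (<-respʳ-≈ (sym (-‿distribˡ-* x y)) (*-pos (neg⇒-pos x<0) 0<y))

  *-neg-neg : ∀ {x y} → x < 0# → y < 0# → 0# < x * y
  *-neg-neg {x} {y} x<0 y<0 = <-respʳ-≈ (solve 2 (λ x y → :- x :* :- y := x :* y) refl x y)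
    (*-pos (neg⇒-pos x<0) (neg⇒-pos y<0))

  x≈0⇒x*y≈0 : ∀ {x} y → x ≈ 0# → x * y ≈ 0#
  x≈0⇒x*y≈0 y x≈0 = trans (*-congʳ x≈0) (zeroˡ y)

  *-nonpos-pos : ∀ {x y} → x ≤ 0# → 0# < y → x * y ≤ 0#
  *-nonpos-pos (inj₁ x<0) 0<y = inj₁ (*-neg-pos x<0 0<y)
  *-nonpos-pos (inj₂ x≈0) _   = inj₂ (x≈0⇒x*y≈0 _ x≈0)

  *-nonpos-neg : ∀ {x y} → x ≤ 0# → y < 0# → 0# ≤ x * y
  *-nonpos-neg (inj₁ x<0) y<0 = inj₁ (*-neg-neg x<0 y<0)
  *-nonpos-neg (inj₂ x≈0) _   = inj₂ (sym (x≈0⇒x*y≈0 _ x≈0))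

  *-nonneg-nonpos : ∀ {x y} → 0# ≤ x → y ≤ 0# → x * y ≤ 0#
  *-nonneg-nonpos (inj₁ 0<x) y≤0 = ≤-respˡ-≈ (*-comm _ _) (*-nonpos-pos y≤0 0<x)
  *-nonneg-nonpos (inj₂ 0≈x) _   = inj₂ (x≈0⇒x*y≈0 _ (sym 0≈x))

  square-pos : ∀ {x} → ¬ (x ≈ 0#) → 0# < x * x
  square-pos {x} x≉0 with compare x 0#
  ... | tri< x<0 _ _ = *-neg-neg x<0 x<0
  ... | tri≈ _ x≈0 _ = contradiction x≈0 x≉0
  ... | tri> _ _ 0<x = *-pos 0<x 0<x

  square-nonneg : ∀ x → 0# ≤ x * x
  square-nonneg x with x ≟ 0#
  ... | yes x≈0 = inj₂ (sym (x≈0⇒x*y≈0 x x≈0))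
  ... | no  x≉0 = inj₁ (square-pos x≉0)

  inverse-pos : ∀ {x y} → 0# < x → x * y ≈ 1# → 0# < y
  inverse-pos {x} {y} 0<x xy≈1 with compare y 0#
  ... | tri< y<0 _ _ = contradiction (<-respˡ-≈ xy≈1 (<-respˡ-≈ (*-comm y x) (*-neg-pos y<0 0<x))) (asym 0<1)
  ... | tri≈ _ y≈0 _ = contradiction (trans (sym xy≈1) (trans (*-comm x y) (x≈0⇒x*y≈0 x y≈0))) 1≉0
  ... | tri> _ _ 0<y = 0<y

  ∑≡sum : ∀ {n} (f : Fin n → Carrier) → ∑ F f ≡ sum f
  ∑≡sum {zero}  f = ≡.refl
  ∑≡sum {suc n} f = ≡.cong (f zero +_) (∑≡sum (λ i → f (suc i)))

  ∑-cong : ∀ {n} {f g : Fin n → Carrier} → (∀ i → f i ≈ g i) → ∑ F f ≈ ∑ F g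
  ∑-cong {f = f} {g} f≈g rewrite ∑≡sum f | ∑≡sum g = sum-cong-≋ f≈g

  ∑-+ : ∀ {n} (f g : Fin n → Carrier) → ∑ F (λ i → f i + g i) ≈ ∑ F f + ∑ F g
  ∑-+ f g rewrite ∑≡sum (λ i → f i + g i) | ∑≡sum f | ∑≡sum g = ∑-distrib-+ f g

  ∑-zero : ∀ n → ∑ F {n} (λ _ → 0#) ≈ 0#
  ∑-zero n rewrite ∑≡sum {n} (λ _ → 0#) = sum-replicate-zero n

  ∑-swap : ∀ {m n} (f : Fin m → Fin n → Carrier) →
           ∑ F (λ i → ∑ F (λ j → f i j)) ≈ ∑ F (λ j → ∑ F (λ i → f i j))
  ∑-swap {zero} {n} f = sym (∑-zero n)
  ∑-swap {suc m}     f = trans (+-congˡ (∑-swap (λ i → f (suc i)))) (sym (∑-+ (f zero) _))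

  *-distribˡ-∑ : ∀ {n} x (f : Fin n → Carrier) → x * ∑ F f ≈ ∑ F (λ i → x * f i)
  *-distribˡ-∑ x f rewrite ∑≡sum f | ∑≡sum (λ i → x * f i) = *-distribˡ-sum x f

  *-distribʳ-∑ : ∀ {n} x (f : Fin n → Carrier) → ∑ F f * x ≈ ∑ F (λ i → f i * x)
  *-distribʳ-∑ x f rewrite ∑≡sum f | ∑≡sum (λ i → f i * x) = *-distribʳ-sum x f

  ∑-neg : ∀ {n} (f : Fin n → Carrier) → ∑ F (λ i → - f i) ≈ - ∑ F f
  ∑-neg {zero}  f = sym -0#≈0#
  ∑-neg {suc n} f = trans (+-congˡ (∑-neg (λ i → f (suc i)))) (-‿+-comm _ _)

  ∑-mono-≤ : ∀ {n} {f g : Fin n → Carrier} → (∀ i → f i ≤ g i) → ∑ F f ≤ ∑ F g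
  ∑-mono-≤ {zero}  f≤g = inj₂ refl
  ∑-mono-≤ {suc n} f≤g = +-mono-≤ (f≤g zero) (∑-mono-≤ (λ i → f≤g (suc i)))

  ∑-mono-<-at : ∀ {n} {f g : Fin n → Carrier} k → f k < g k → (∀ i → f i ≤ g i) → ∑ F f < ∑ F g
  ∑-mono-<-at zero    fk<gk f≤g = +-mono-<-≤ fk<gk (∑-mono-≤ (λ i → f≤g (suc i)))
  ∑-mono-<-at (suc k) fk<gk f≤g = +-mono-≤-< (f≤g zero) (∑-mono-<-at k fk<gk (λ i → f≤g (suc i)))

  ∑-nonpos : ∀ {n} {f : Fin n → Carrier} → (∀ i → f i ≤ 0#) → ∑ F f ≤ 0#
  ∑-nonpos {n} f≤0 = ≤-respʳ-≈ (∑-zero n) (∑-mono-≤ f≤0)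

  ∑-sub-scaled : ∀ {n} (f g : Fin n → Carrier) s → ∑ F (λ i → f i - g i * s) ≈ ∑ F f - ∑ F g * s
  ∑-sub-scaled f g s = begin
    ∑ F (λ i → f i - g i * s)          ≈⟨ ∑-+ f (λ i → - (g i * s)) ⟩
    ∑ F f + ∑ F (λ i → - (g i * s))    ≈⟨ +-congˡ (∑-neg (λ i → g i * s)) ⟩
    ∑ F f - ∑ F (λ i → g i * s)        ≈⟨ +-congˡ (-‿cong (*-distribʳ-∑ s g)) ⟨
    ∑ F f - ∑ F g * s                  ∎

  -- Farkas' lemma

  infix 7 _·_
  _·_ : ∀ {m} → Vector Carrier m → Vector Carrier m → Carrier
  u · v = ∑ F (λ c → u c * v c)

  ·-sub-scaledʳ : ∀ {m} (u v w : Vector Carrier m) s → u · (λ c → v c - s * w c) ≈ u · v - (u · w) * s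
  ·-sub-scaledʳ u v w s = trans
    (∑-cong (λ c → solve 4 (λ u v w s → u :* (v :- s :* w) := u :* v :- (u :* w) :* s) refl (u c) (v c) (w c) s))
    (∑-sub-scaled (λ c → u c * v c) (λ c → u c * w c) s)

  ·-sub-scaledˡ : ∀ {m} (u w v : Vector Carrier m) s → (λ c → u c - s * w c) · v ≈ u · v - (w · v) * s
  ·-sub-scaledˡ u w v s = trans
    (∑-cong (λ c → solve 4 (λ u v w s → (u :- s :* w) :* v := u :* v :- (w :* v) :* s) refl (u c) (v c) (w c) s))
    (∑-sub-scaled (λ c → u c * v c) (λ c → w c * v c) s)

  ConicCombination : ∀ {k m} → (Fin k → Vector Carrier m) → Vector Carrier m → Set (c ⊔ ℓ ⊔ ℓ')
  ConicCombination {k} a b =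
    ∃ λ (y : Vector Carrier k) → (∀ i → 0# ≤ y i) × (∀ c → b c ≈ ∑ F (λ i → y i * a i c))

  Separator : ∀ {k m} → (Fin k → Vector Carrier m) → Vector Carrier m → Set (c ⊔ ℓ ⊔ ℓ')
  Separator {m = m} a b = ∃ λ (x : Vector Carrier m) → (∀ i → a i · x ≤ 0#) × (0# < b · x)

  pos-nonpos⇒sub-pos : ∀ {p s} → 0# < p → s ≤ 0# → 0# < p - s
  pos-nonpos⇒sub-pos {p} {s} 0<p s≤0 =
    <-respˡ-≈ (+-identityʳ 0#) (+-mono-<-≤ 0<p (nonpos⇒-nonneg s≤0))
    where
    nonpos⇒-nonneg : ∀ {s} → s ≤ 0# → 0# ≤ - s
    nonpos⇒-nonneg (inj₁ s<0) = inj₁ (neg⇒-pos s<0)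
    nonpos⇒-nonneg (inj₂ s≈0) = inj₂ (sym (trans (-‿cong s≈0) -0#≈0#))

  module FarkasStep {k m} (a : Fin (suc k) → Vector Carrier m) (b x : Vector Carrier m)
                    {β} (0<a₀·x : 0# < a zero · x) (a₀·xβ≈1 : (a zero · x) * β ≈ 1#) where

    a₀ = a zero

    -- π v is v moved along a₀ onto the hyperplane x · _ = 0.
    π : Vector Carrier m → Vector Carrier m
    π v c = v c - ((v · x) * β) * a₀ c

    conic-lift : (∀ i → a (suc i) · x ≤ 0#) → 0# < b · x →
                 ConicCombination (λ i → π (a (suc i))) (π b) → ConicCombination a b
    conic-lift a·x≤0 0<b·x (y , y≥0 , πb≈) = (t ∷ y) , t∷y≥0 , b≈
      where
      0<β = inverse-pos 0<a₀·x a₀·xβ≈1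
      S = ∑ F (λ i → y i * ((a (suc i) · x) * β))
      t = (b · x) * β - S

      t∷y≥0 : ∀ i → 0# ≤ (t ∷ y) i
      t∷y≥0 zero    = inj₁ (pos-nonpos⇒sub-pos (*-pos 0<b·x 0<β)
                        (∑-nonpos (λ i → *-nonneg-nonpos (y≥0 i) (*-nonpos-pos (a·x≤0 i) 0<β))))
      t∷y≥0 (suc i) = y≥0 i

      b≈ : ∀ c → b c ≈ t * a₀ c + ∑ F (λ i → y i * a (suc i) c)
      b≈ c = begin
        b c
          ≈⟨ solve 2 (λ v w → v := (v :- w) :+ w) refl (b c) _ ⟩
        π b c + ((b · x) * β) * a₀ c
          ≈⟨ +-congʳ (πb≈ c) ⟩
        ∑ F (λ i → y i * π (a (suc i)) c) + ((b · x) * β) * a₀ c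
          ≈⟨ +-congʳ (∑-cong (λ i → solve 4 (λ y u r w → y :* (u :- r :* w) := y :* u :- (y :* r) :* w) refl
                                           (y i) (a (suc i) c) ((a (suc i) · x) * β) (a₀ c))) ⟩
        ∑ F (λ i → y i * a (suc i) c - (y i * ((a (suc i) · x) * β)) * a₀ c) + ((b · x) * β) * a₀ c
          ≈⟨ +-congʳ (∑-sub-scaled (λ i → y i * a (suc i) c) (λ i → y i * ((a (suc i) · x) * β)) (a₀ c)) ⟩
        (∑ F (λ i → y i * a (suc i) c) - S * a₀ c) + ((b · x) * β) * a₀ c
          ≈⟨ solve 4 (λ Y S w p → (Y :- S :* w) :+ p :* w := (p :- S) :* w :+ Y) refl _ S (a₀ c) _ ⟩
        t * a₀ c + ∑ F (λ i → y i * a (suc i) c)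
          ∎

    separator-lift : Separator (λ i → π (a (suc i))) (π b) → Separator a b
    separator-lift (x′ , πa·x′≤0 , 0<πb·x′) = x″ , x″-bounds , <-respʳ-≈ (sym (·x″≈π·x′ b)) 0<πb·x′
      where
      x″ : Vector Carrier m
      x″ c = x′ c - ((a₀ · x′) * β) * x c

      ·x″≈π·x′ : ∀ v → v · x″ ≈ π v · x′
      ·x″≈π·x′ v = begin
        v · x″
          ≈⟨ ·-sub-scaledʳ v x′ x _ ⟩
        v · x′ - (v · x) * ((a₀ · x′) * β)
          ≈⟨ solve 4 (λ p q r β → p :- q :* (r :* β) := p :- r :* (q :* β)) refl _ (v · x) (a₀ · x′) β ⟩
        v · x′ - (a₀ · x′) * ((v · x) * β)
          ≈⟨ ·-sub-scaledˡ v a₀ x′ _ ⟨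
        π v · x′
          ∎

      a₀·x″≈0 : a₀ · x″ ≈ 0#
      a₀·x″≈0 = begin
        a₀ · x″
          ≈⟨ ·-sub-scaledʳ a₀ x′ x _ ⟩
        a₀ · x′ - (a₀ · x) * ((a₀ · x′) * β)
          ≈⟨ solve 3 (λ p α β → p :- α :* (p :* β) := p :- p :* (α :* β)) refl _ _ β ⟩
        a₀ · x′ - (a₀ · x′) * ((a₀ · x) * β)
          ≈⟨ +-congˡ (-‿cong (trans (*-congˡ a₀·xβ≈1) (*-identityʳ _))) ⟩
        a₀ · x′ - a₀ · x′
          ≈⟨ -‿inverseʳ _ ⟩
        0#
          ∎

      x″-bounds : ∀ i → a i · x″ ≤ 0#
      x″-bounds zero    = inj₂ a₀·x″≈0
      x″-bounds (suc i) = ≤-respˡ-≈ (sym (·x″≈π·x′ (a (suc i)))) (πa·x′≤0 i)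

  -- Induction on the number of vectors: when a separator x of a₁, a₂, … has a₀ · x > 0, recurse on the
  -- family projected by π and lift the answer back.
  farkas : ∀ {k m} (a : Fin k → Vector Carrier m) b → ConicCombination a b ⊎ Separator a b
  farkas {zero} {m} a b with all? (λ c → b c ≟ 0#)
  ... | yes b≈0 = inj₁ ((λ ()) , (λ ()) , b≈0)
  ... | no  b≉0 with ¬∀⟶∃¬ m _ (λ c → b c ≟ 0#) b≉0
  ...   | j , bj≉0 = inj₂ (b , (λ ()) , <-respˡ-≈ (∑-zero m)
                         (∑-mono-<-at j (square-pos bj≉0) (λ c → square-nonneg (b c))))
  farkas {suc k} a b with farkas (λ i → a (suc i)) b
  ... | inj₁ (y , y≥0 , b≈) = inj₁ ((0# ∷ y) , (λ { zero → inj₂ refl ; (suc i) → y≥0 i }) ,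
                                    λ c → trans (b≈ c) (sym (trans (+-congʳ (zeroˡ _)) (+-identityˡ _))))
  ... | inj₂ (x , a·x≤0 , 0<b·x) with 0# <? a zero · x
  ...   | no  a₀·x≯0 = inj₂ (x , (λ { zero → ≮⇒≥ a₀·x≯0 ; (suc i) → a·x≤0 i }) , 0<b·x)
  ...   | yes 0<a₀·x with inverse (a zero · x) (λ a₀·x≈0 → irrefl (sym a₀·x≈0) 0<a₀·x)
  ...     | β , a₀·xβ≈1 =
    Sum.map (conic-lift a·x≤0 0<b·x) separator-lift (farkas (λ i → π (a (suc i))) (π b))
    where open FarkasStep a b x 0<a₀·x a₀·xβ≈1

  lift : ∀ {d} → Point F d → Vector Carrier (suc d)
  lift v = appendLast F v 1#

  lift-combination : ∀ {d n} (p : Fin n → Point F d) x w →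
                     ∑ F w ≈ 1# → (∀ k → ∑ F (λ i → w i * p i k) ≈ x k) →
                     ∀ c → ∑ F (λ i → w i * lift (p i) c) ≈ lift x c
  lift-combination {zero}  p x w ∑w≈1 _     zero    = trans (∑-cong (λ i → *-identityʳ (w i))) ∑w≈1
  lift-combination {suc d} p x w _     ∑wp≈x zero    = ∑wp≈x zero
  lift-combination {suc d} p x w ∑w≈1 ∑wp≈x (suc c) =
    lift-combination (λ i k → p i (suc k)) (λ k → x (suc k)) w ∑w≈1 (λ k → ∑wp≈x (suc k)) c

  lift-combination⁻¹ : ∀ {d n} (p : Fin n → Point F d) x w →
                       (∀ c → ∑ F (λ i → w i * lift (p i) c) ≈ lift x c) →
                       ∑ F w ≈ 1# × (∀ k → ∑ F (λ i → w i * p i k) ≈ x k)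
  lift-combination⁻¹ {zero}  p x w ∑wp≈x =
    trans (∑-cong (λ i → sym (*-identityʳ (w i)))) (∑wp≈x zero) , λ ()
  lift-combination⁻¹ {suc d} p x w ∑wp≈x =
    proj₁ tail , λ { zero → ∑wp≈x zero ; (suc k) → proj₂ tail k }
    where tail = lift-combination⁻¹ (λ i k → p i (suc k)) (λ k → x (suc k)) w (λ c → ∑wp≈x (suc c))

  ·-congˡ : ∀ {m} {u v : Vector Carrier m} z → (∀ c → u c ≈ v c) → u · z ≈ v · z
  ·-congˡ {m} z u≈v = ∑-cong {m} (λ c → *-congʳ (u≈v c))

  ∑w[u·z]≈[∑wu]·z : ∀ {n m} (w : Fin n → Carrier) (u : Fin n → Vector Carrier m) z →
          ∑ F (λ i → w i * (u i · z)) ≈ (λ c → ∑ F (λ i → w i * u i c)) · z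
  ∑w[u·z]≈[∑wu]·z {n} {m} w u z = begin
    ∑ F (λ i → w i * (u i · z))
      ≈⟨ ∑-cong {n} (λ i → *-distribˡ-∑ (w i) (λ c → u i c * z c)) ⟩
    ∑ F (λ i → ∑ F (λ c → w i * (u i c * z c)))
      ≈⟨ ∑-swap (λ i c → w i * (u i c * z c)) ⟩
    ∑ F (λ c → ∑ F (λ i → w i * (u i c * z c)))
      ≈⟨ ∑-cong {m} (λ c → ∑-cong {n} (λ i → *-assoc _ _ _)) ⟨
    ∑ F (λ c → ∑ F (λ i → w i * u i c * z c))
      ≈⟨ ∑-cong {m} (λ c → *-distribʳ-∑ (z c) (λ i → w i * u i c)) ⟨
    (λ c → ∑ F (λ i → w i * u i c)) · z
      ∎

  affine-combination : ∀ {d n} (p : Fin n → Point F d) x w (z : Vector Carrier (suc d)) →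
                       ∑ F w ≈ 1# → (∀ k → ∑ F (λ i → w i * p i k) ≈ x k) →
                       ∑ F (λ i → w i * (lift (p i) · z)) ≈ lift x · z
  affine-combination p x w z ∑w≈1 ∑wp≈x =
    trans (∑w[u·z]≈[∑wu]·z w (λ i → lift (p i)) z) (·-congˡ z (lift-combination p x w ∑w≈1 ∑wp≈x))

  masked : ∀ {A : Set} → Dec A → Carrier → Carrier
  masked (yes _) v = v
  masked (no _)  _ = 0#

  masked-yes : ∀ {A : Set} (A? : Dec A) {v} → A → masked A? v ≈ v
  masked-yes (yes _) _ = refl
  masked-yes (no ¬a) a = contradiction a ¬a

  masked-no : ∀ {A : Set} (A? : Dec A) {v} → ¬ A → masked A? v ≈ 0#
  masked-no (yes a) ¬a = contradiction a ¬a
  masked-no (no _)  _  = refl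

  masked-nonneg : ∀ {A : Set} (A? : Dec A) {v} → 0# ≤ v → 0# ≤ masked A? v
  masked-nonneg (yes _) 0≤v = 0≤v
  masked-nonneg (no _)  _   = inj₂ refl

  masked-*-comm : ∀ {A : Set} (A? : Dec A) u v → u * masked A? v ≈ masked A? u * v
  masked-*-comm (yes _) u v = refl
  masked-*-comm (no _)  u v = trans (zeroʳ u) (sym (zeroˡ v))

  separation : ∀ {d n} (p : Fin n → Point F d) {S : Fin n → Set} → Decidable S → ∀ x →
               InConv F p S x ⊎ ∃ λ z → (∀ i → S i → lift (p i) · z ≤ 0#) × 0# < lift x · z
  separation {d} {n} p S? x with farkas (λ i c → masked (S? i) (lift (p i) c)) (lift x)
  ... | inj₁ (y , y≥0 , x≈∑ya) =
    inj₁ (w , (λ i → masked-nonneg (S? i) (y≥0 i)) , (λ i → masked-no (S? i)) , lift-combination⁻¹ p x w ∑wp≈x)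
    where
    w : Fin n → Carrier
    w i = masked (S? i) (y i)
    ∑wp≈x : ∀ c → ∑ F (λ i → w i * lift (p i) c) ≈ lift x c
    ∑wp≈x c = sym (trans (x≈∑ya c) (∑-cong {n} (λ i → masked-*-comm (S? i) (y i) (lift (p i) c))))
  ... | inj₂ (z , a·z≤0 , 0<x·z) =
    inj₂ (z , (λ i Si → ≤-respˡ-≈ (·-congˡ {v = lift (p i)} z (λ c → masked-yes (S? i) Si)) (a·z≤0 i)) ,
          0<x·z)

  positive-vertex : ∀ {d n} (p : Fin n → Point F d) {S : Fin n → Set} → Decidable S → ∀ {x} z →
                    InConv F p S x → 0# < lift x · z → ∃ λ i → S i × 0# < lift (p i) · z
  positive-vertex {n = n} p S? z (w , w≥0 , w-off-S , ∑w≈1 , ∑wp≈x) 0<x·z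
    with any? (λ i → S? i ×-dec (0# <? lift (p i) · z))
  ... | yes found = found
  ... | no  none  = contradiction (<-respʳ-≈ (sym (affine-combination p _ w z ∑w≈1 ∑wp≈x)) 0<x·z)
                                  (≤⇒≯ (∑-nonpos term≤0))
    where
    term≤0 : ∀ i → w i * (lift (p i) · z) ≤ 0#
    term≤0 i with S? i
    ... | yes Si = *-nonneg-nonpos (w≥0 i) (≮⇒≥ (λ 0<pz → none (i , Si , 0<pz)))
    ... | no ¬Si = inj₂ (x≈0⇒x*y≈0 _ (w-off-S i ¬Si))

  -- determinants

  Matrix : ℕ → ℕ → Set c
  Matrix m n = Fin m → Fin n → Carrier

  minor : ∀ {n} → Matrix (suc n) (suc n) → Fin (suc n) → Fin (suc n) → Matrix n n
  minor A i j r k = A (punchIn i r) (punchIn j k)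

  det-cong : ∀ {n} (A B : Matrix n n) → (∀ i j → A i j ≈ B i j) → det F A ≈ det F B
  det-cong {zero}  A B A≈B = refl
  det-cong {suc n} A B A≈B = ∑-cong {suc n} {λ j → altSign F (toℕ j) * (A zero j * det F (minor A zero j))}
    (λ j → *-congˡ (*-cong (A≈B zero j) (det-cong (minor A zero j) (minor B zero j) (λ r k → A≈B _ _))))

  *-*-distrib-∑ : ∀ {n} x y (f : Fin n → Carrier) → x * (y * ∑ F f) ≈ ∑ F (λ i → x * (y * f i))
  *-*-distrib-∑ x y f = trans (*-congˡ (*-distribˡ-∑ y f)) (*-distribˡ-∑ x (λ i → y * f i))

  colTerm : ∀ {n} → Matrix (suc n) (suc n) → Fin (suc n) → Carrier
  colTerm A i = altSign F (toℕ i) * (A i zero * det F (minor A i zero))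

  det-expand-col₀ : ∀ {n} (A : Matrix (suc n) (suc n)) → det F A ≈ ∑ F (colTerm A)
  det-expand-col₀ {zero}  A = refl
  det-expand-col₀ {suc n} A = +-congˡ (begin
    ∑ F (λ j → - alt j * (A zero (suc j) * det F (minor A zero (suc j))))
      ≈⟨ ∑-cong {suc n} {λ j → - alt j * (A zero (suc j) * det F (minor A zero (suc j)))}
                (λ j → *-congˡ (*-congˡ (det-expand-col₀ (minor A zero (suc j))))) ⟩
    ∑ F (λ j → - alt j * (A zero (suc j) * ∑ F (λ i → alt i * (A (suc i) zero * det F (C i j)))))
      ≈⟨ ∑-cong {suc n} (λ j → trans
           (*-*-distrib-∑ (- alt j) (A zero (suc j)) (λ i → alt i * (A (suc i) zero * det F (C i j))))
           (∑-cong {suc n} (λ i → reorder (alt j) (A zero (suc j)) (alt i) (A (suc i) zero) (det F (C i j))))) ⟩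
    ∑ F (λ j → ∑ F (λ i → - alt i * (A (suc i) zero * (alt j * (A zero (suc j) * det F (C i j))))))
      ≈⟨ ∑-swap (λ j i → - alt i * (A (suc i) zero * (alt j * (A zero (suc j) * det F (C i j))))) ⟩
    ∑ F (λ i → ∑ F (λ j → - alt i * (A (suc i) zero * (alt j * (A zero (suc j) * det F (C i j))))))
      ≈⟨ ∑-cong {suc n} (λ i →
           *-*-distrib-∑ (- alt i) (A (suc i) zero) (λ j → alt j * (A zero (suc j) * det F (C i j)))) ⟨
    ∑ F (λ i → - alt i * (A (suc i) zero * det F (minor A (suc i) zero)))
      ∎)
    where
    alt = λ (i : Fin (suc n)) → altSign F (toℕ i)
    -- C i j is both the (i, 0) minor of minor A 0 (j+1) and the (0, j) minor of minor A (i+1) 0.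
    C : Fin (suc n) → Fin (suc n) → Matrix n n
    C i j r k = A (suc (punchIn i r)) (suc (punchIn j k))
    reorder : ∀ a x b y u → - a * (x * (b * (y * u))) ≈ - b * (y * (a * (x * u)))
    reorder = solve 5 (λ a x b y u → :- a :* (x :* (b :* (y :* u))) := :- b :* (y :* (a :* (x :* u)))) refl

  Swapped₀₁ : ∀ {n m} → Matrix (suc (suc n)) m → Matrix (suc (suc n)) m → Set ℓ
  Swapped₀₁ A B = (∀ k → A zero k ≈ B (suc zero) k) × (∀ k → A (suc zero) k ≈ B zero k)
                × (∀ i k → A (suc (suc i)) k ≈ B (suc (suc i)) k)

  det-swap₀₁ : ∀ {n} (A B : Matrix (suc (suc n)) (suc (suc n))) → Swapped₀₁ A B → det F A ≈ - det F B
  ∑-tail-swap₀₁ : ∀ {n} (A B : Matrix (suc (suc n)) (suc (suc n))) → Swapped₀₁ A B →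
    ∑ F (λ i → colTerm A (suc (suc i))) ≈ - ∑ F (λ i → colTerm B (suc (suc i)))

  det-swap₀₁ A B A⇄B@(A₀≈B₁ , A₁≈B₀ , A₂₊≈B₂₊) = begin
    det F A                                       ≈⟨ det-expand-col₀ A ⟩
    1# * (A zero zero * X₀) + (- 1# * (A (suc zero) zero * X₁) + ∑ F (λ i → colTerm A (suc (suc i))))
      ≈⟨ +-cong (*-congˡ (*-cong (A₀≈B₁ zero) (det-cong _ _ X₀≈Y₁)))
                (+-cong (*-congˡ (*-cong (A₁≈B₀ zero) (det-cong _ _ X₁≈Y₀))) (∑-tail-swap₀₁ A B A⇄B)) ⟩
    1# * (B (suc zero) zero * Y₁) + (- 1# * (B zero zero * Y₀) + - ∑ F (λ i → colTerm B (suc (suc i))))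
      ≈⟨ solve 4 (λ o u v t → o :* u :+ (:- o :* v :+ :- t) := :- (o :* v :+ (:- o :* u :+ t))) refl 1# _ _ _ ⟩
    - (1# * (B zero zero * Y₀) + (- 1# * (B (suc zero) zero * Y₁) + ∑ F (λ i → colTerm B (suc (suc i)))))
                                                  ≈⟨ -‿cong (det-expand-col₀ B) ⟨
    - det F B                                     ∎
    where
    X₀ = det F (minor A zero zero)
    X₁ = det F (minor A (suc zero) zero)
    Y₀ = det F (minor B zero zero)
    Y₁ = det F (minor B (suc zero) zero)
    X₀≈Y₁ : ∀ r k → minor A zero zero r k ≈ minor B (suc zero) zero r k
    X₀≈Y₁ zero    k = A₁≈B₀ (suc k)
    X₀≈Y₁ (suc r) k = A₂₊≈B₂₊ r (suc k)
    X₁≈Y₀ : ∀ r k → minor A (suc zero) zero r k ≈ minor B zero zero r k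
    X₁≈Y₀ zero    k = A₀≈B₁ (suc k)
    X₁≈Y₀ (suc r) k = A₂₊≈B₂₊ r (suc k)

  ∑-tail-swap₀₁ {zero}  _ _ _ = sym -0#≈0#
  ∑-tail-swap₀₁ {suc n} A B (A₀≈B₁ , A₁≈B₀ , A₂₊≈B₂₊) =
    trans (∑-cong {suc n} {λ i → colTerm A (suc (suc i))} term) (∑-neg (λ i → colTerm B (suc (suc i))))
    where
    minor⇄ : ∀ i → Swapped₀₁ (minor A (suc (suc i)) zero) (minor B (suc (suc i)) zero)
    minor⇄ i = (λ k → A₀≈B₁ (suc k)) , (λ k → A₁≈B₀ (suc k)) , (λ r k → A₂₊≈B₂₊ (punchIn i r) (suc k))
    term : ∀ i → colTerm A (suc (suc i)) ≈ - colTerm B (suc (suc i))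
    term i = trans
      (*-congˡ (*-cong (A₂₊≈B₂₊ i zero)
                       (det-swap₀₁ (minor A (suc (suc i)) zero) (minor B (suc (suc i)) zero) (minor⇄ i))))
      (solve 3 (λ a b u → a :* (b :* :- u) := :- (a :* (b :* u))) refl _ _ _)

  det-zeroMinors : ∀ {n} (A : Matrix (suc n) (suc n)) → (∀ j → det F (minor A zero j) ≈ 0#) → det F A ≈ 0#
  det-zeroMinors {n} A minors≈0 = trans
    (∑-cong {suc n} {λ j → altSign F (toℕ j) * (A zero j * det F (minor A zero j))}
            (λ j → trans (*-congˡ (trans (*-congˡ (minors≈0 j)) (zeroʳ _))) (zeroʳ _)))
    (∑-zero (suc n))

  swapRows₀₁ : ∀ {n m} → Matrix (suc (suc n)) m → Matrix (suc (suc n)) m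
  swapRows₀₁ A zero          = A (suc zero)
  swapRows₀₁ A (suc zero)    = A zero
  swapRows₀₁ A (suc (suc i)) = A (suc (suc i))

  det-equalRows : ∀ {n} (A : Matrix (suc n) (suc n)) r → (∀ k → A zero k ≈ A (suc r) k) → det F A ≈ 0#
  det-equalRows {suc n} A zero    A₀≈A₁ =
    x≈-x⇒x≈0 (det-swap₀₁ A A (A₀≈A₁ , (λ k → sym (A₀≈A₁ k)) , (λ i k → refl)))
  -- After swapping rows 0 and 1 the equal rows lie in every minor along the first row.
  det-equalRows {suc n} A (suc r) A₀≈Aᵣ = begin
    det F A    ≈⟨ det-swap₀₁ A B ((λ k → refl) , (λ k → refl) , (λ i k → refl)) ⟩
    - det F B  ≈⟨ -‿cong (det-zeroMinors B (λ j → det-equalRows (minor B zero j) r (λ k → A₀≈Aᵣ _))) ⟩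
    - 0#       ≈⟨ -0#≈0# ⟩
    0#         ∎
    where B = swapRows₀₁ A

  det-row₀-combination : ∀ {n} (A : Matrix (suc n) (suc n)) (z : Fin n → Carrier) →
                         (∀ k → A zero k ≈ ∑ F (λ r → z r * A (suc r) k)) → det F A ≈ 0#
  det-row₀-combination {n} A z A₀≈∑zA = begin
    ∑ F (λ j → alt j * (A zero j * M j))
      ≈⟨ ∑-cong {suc n} {λ j → alt j * (A zero j * M j)} expand-row₀ ⟩
    ∑ F (λ j → ∑ F (λ r → z r * (alt j * (A (suc r) j * M j))))
      ≈⟨ ∑-swap (λ j r → z r * (alt j * (A (suc r) j * M j))) ⟩
    ∑ F (λ r → ∑ F (λ j → z r * (alt j * (A (suc r) j * M j))))
      ≈⟨ ∑-cong {n} (λ r → *-distribˡ-∑ (z r) (λ j → alt j * (A (suc r) j * M j))) ⟨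
    ∑ F (λ r → z r * det F (A (suc r) ∷ (λ i → A (suc i))))
      ≈⟨ ∑-cong {n} (λ r → trans (*-congˡ (det-equalRows (A (suc r) ∷ (λ i → A (suc i))) r (λ k → refl)))
                                 (zeroʳ (z r))) ⟩
    ∑ F {n} (λ _ → 0#)
      ≈⟨ ∑-zero n ⟩
    0#
      ∎
    where
    alt = λ (j : Fin (suc n)) → altSign F (toℕ j)
    M = λ j → det F (minor A zero j)
    expand-row₀ : ∀ j → alt j * (A zero j * M j) ≈ ∑ F (λ r → z r * (alt j * (A (suc r) j * M j)))
    expand-row₀ j = begin
      alt j * (A zero j * M j)                       ≈⟨ *-congˡ (*-congʳ (A₀≈∑zA j)) ⟩
      alt j * (∑ F (λ r → z r * A (suc r) j) * M j)  ≈⟨ *-congˡ (*-distribʳ-∑ (M j) (λ r → z r * A (suc r) j)) ⟩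
      alt j * ∑ F (λ r → z r * A (suc r) j * M j)    ≈⟨ *-distribˡ-∑ (alt j) (λ r → z r * A (suc r) j * M j) ⟩
      ∑ F (λ r → alt j * (z r * A (suc r) j * M j))  ≈⟨ ∑-cong {n} (λ r → solve 4
                                                          (λ a z x m → a :* (z :* x :* m) := z :* (a :* (x :* m)))
                                                          refl _ _ _ _) ⟩
      ∑ F (λ r → z r * (alt j * (A (suc r) j * M j))) ∎

  -- an affine sign pattern obstructs homogeneous orientation

  punchIn-strictlyIncreasing : ∀ {n} (i : Fin (suc n)) → StrictlyIncreasing F (punchIn i)
  punchIn-strictlyIncreasing zero    a       b       a<b       = s≤s a<b
  punchIn-strictlyIncreasing (suc i) zero    (suc b) _         = s≤s z≤n
  punchIn-strictlyIncreasing (suc i) (suc a) (suc b) (s≤s a<b) = s≤s (punchIn-strictlyIncreasing i a b a<b)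

  homogeneous-∘ : ∀ {d n m} (p : Fin n → Point F d) (ι : Fin m → Fin n) → StrictlyIncreasing F ι →
                  OrientationHomogeneous F p → OrientationHomogeneous F (λ a → p (ι a))
  homogeneous-∘ p ι ι↑ = Sum.map (λ all>0 j j↑ → all>0 (λ a → ι (j a)) (ι∘↑ j↑))
                                 (λ all<0 j j↑ → all<0 (λ a → ι (j a)) (ι∘↑ j↑))
    where
    ι∘↑ : ∀ {k} {j : Fin k → Fin _} → StrictlyIncreasing F j → StrictlyIncreasing F (λ a → ι (j a))
    ι∘↑ j↑ a b a<b = ι↑ _ _ (j↑ a b a<b)

  alternating-signs⇒¬homogeneous :
    ∀ {d} (q : Fin (suc (suc d)) → Point F d) (z : Vector Carrier (suc d)) t₀ →
    (∀ t → altSign F (toℕ t) * (lift (q t) · z) ≤ 0#) → altSign F (toℕ t₀) * (lift (q t₀) · z) < 0# →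
    ¬ OrientationHomogeneous F q
  alternating-signs⇒¬homogeneous {d} q z t₀ signs≤0 sign<0 = λ
    { (inj₁ all>0) → let D>0 = λ t → all>0 (punchIn t) (punchIn-strictlyIncreasing t) in
        irrefl det≈0 (<-respʳ-≈ (∑-zero (suc (suc d)))
          (∑-mono-<-at t₀ (<-respˡ-≈ (term≈ t₀) (*-neg-pos sign<0 (D>0 t₀)))
                          (λ t → ≤-respˡ-≈ (term≈ t) (*-nonpos-pos (signs≤0 t) (D>0 t)))))
    ; (inj₂ all<0) → let D<0 = λ t → all<0 (punchIn t) (punchIn-strictlyIncreasing t) in
        irrefl (sym det≈0) (<-respˡ-≈ (∑-zero (suc (suc d)))
          (∑-mono-<-at t₀ (<-respʳ-≈ (term≈ t₀) (*-neg-neg sign<0 (D<0 t₀)))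
                          (λ t → ≤-respʳ-≈ (term≈ t) (*-nonpos-neg (signs≤0 t) (D<0 t)))))
    }
    where
    h = λ t → lift (q t) · z
    D = λ t → det F (orientMatrix F (λ a → q (punchIn t a)))
    -- The first row of N is a combination of the others, and its expansion along that row is ∑ ± h t * D t.
    N : Matrix (suc (suc d)) (suc (suc d))
    N = h ∷ (λ c t → lift (q t) c)
    det≈0 : det F N ≈ 0#
    det≈0 = det-row₀-combination N z (λ t → ∑-cong {suc d} {λ c → lift (q t) c * z c} (λ c → *-comm _ _))
    term≈ : ∀ t → altSign F (toℕ t) * h t * D t ≈ altSign F (toℕ t) * (h t * D t)
    term≈ t = *-assoc _ _ _

  altSign-pattern : ∀ {n} (h : Fin n → Carrier) u i →
                    SignPattern (λ i → ¬ 0# < h i) (λ i → 0# < h i) u i → altSign F u * h i ≤ 0#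
  altSign-pattern h zero          i h≯0 = ≤-respˡ-≈ (sym (*-identityˡ _)) (≮⇒≥ h≯0)
  altSign-pattern h (suc zero)    i 0<h = inj₁ (<-respˡ-≈ (sym (-1*x≈-x _)) (pos⇒-neg 0<h))
  altSign-pattern h (suc (suc u)) i pat = ≤-respˡ-≈ (*-congʳ (sym (-‿involutive _))) (altSign-pattern h u i pat)

  odd-hulls⇒even-hull : ∀ {d N s} → suc (suc d) ℕ.≤ suc (double s) →
    (p : Fin (2 ℕ.* N ℕ.+ 1) → Point F d) → OrientationHomogeneous F p →
    ∀ x (col : Fin (2 ℕ.* N ℕ.+ 1) → Fin s) →
    (∀ j → InConv F p (λ i → Odd (toℕ i) × col i ≡ j) x) → InConv F p (λ i → Even (toℕ i)) x
  odd-hulls⇒even-hull {d} {N} d+2≤ p homogeneous x col x∈Qⱼ with separation p (λ i → toℕ i % 2 ℕ.≟ 0) x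
  ... | inj₁ x∈R               = x∈R
  ... | inj₂ (z , R≤0 , 0<h[x]) =
    contradiction (homogeneous-∘ p ι ι↑ homogeneous)
                  (alternating-signs⇒¬homogeneous (λ t → p (ι t)) z (suc zero) signs≤0 sign₁<0)
    where
    h = λ i → lift (p i) · z
    last = even-last-index N
    open AlternatingChain (λ i → ¬ 0# < h i) (λ i → 0# < h i) (λ i even → ≤⇒≯ (R≤0 i even))
                          (proj₁ last) (proj₁ (proj₂ last)) (proj₂ (proj₂ last))
    C = coloured-chain col (λ j → positive-vertex p (λ i → (toℕ i % 2 ℕ.≟ 1) ×-dec (col i ≟ᶠ j))
                                                  z (x∈Qⱼ j) 0<h[x])

    ι : Fin (suc (suc d)) → Fin (2 ℕ.* N ℕ.+ 1)
    ι t = proj₁ C (Fin.inject≤ t d+2≤)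
    ι↑ : StrictlyIncreasing F ι
    ι↑ a b a<b =
      proj₁ (proj₂ C) (≡.subst₂ ℕ._<_ (≡.sym (toℕ-inject≤ a d+2≤)) (≡.sym (toℕ-inject≤ b d+2≤)) a<b)
    ι-signs : ∀ t → SignPattern (λ i → ¬ 0# < h i) (λ i → 0# < h i) (toℕ t) (ι t)
    ι-signs t = ≡.subst (λ u → SignPattern _ _ u (ι t)) (toℕ-inject≤ t d+2≤)
                        (proj₂ (proj₂ (proj₂ C)) (Fin.inject≤ t d+2≤))
    signs≤0 : ∀ t → altSign F (toℕ t) * h (ι t) ≤ 0#
    signs≤0 t = altSign-pattern h (toℕ t) (ι t) (ι-signs t)
    sign₁<0 : - 1# * h (ι (suc zero)) < 0#
    sign₁<0 = <-respˡ-≈ (sym (-1*x≈-x _)) (pos⇒-neg (ι-signs (suc zero)))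

double-+1 : ∀ m → double (m ℕ.+ 1) ≡ suc (suc (double m))
double-+1 zero    = ≡.refl
double-+1 (suc m) = ≡.cong (λ k → suc (suc k)) (double-+1 m)

double≡*2 : ∀ m → double m ≡ m ℕ.* 2
double≡*2 zero    = ≡.refl
double≡*2 (suc m) = ≡.cong (λ k → suc (suc k)) (double≡*2 m)

d+2≤2[d/2+1]+1 : ∀ d → suc (suc d) ℕ.≤ suc (double (d / 2 ℕ.+ 1))
d+2≤2[d/2+1]+1 d rewrite double-+1 (d / 2) | double≡*2 (d / 2) =
  s≤s (s≤s (≡.subst (ℕ._≤ suc (d / 2 ℕ.* 2)) (≡.sym (m≡m%n+[m/n]*n d 2))
                    (ℕ.+-monoˡ-≤ (d / 2 ℕ.* 2) (ℕ.m<1+n⇒m≤n (m%n<n d 2)))))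

open import Data.Nat using (_+_; _*_; _∸_; _/_; _%_)
import Data.Nat

lemma4 : ∀ {c ℓ ℓ' : Level} (F : OrderedField c ℓ ℓ') (d : ℕ) → 1 Data.Nat.≤ d →
    let s = d / 2 + 1
        D = (s ∸ 1) * (d + 1) + 1
    in (p : Fin (2 * D + 1) → Point F d) → OrientationHomogeneous F p →
       (x : Point F d) →
       (Σ (Fin (2 * D + 1) → Fin s) λ col →
          ∀ (j : Fin s) → InConv F p (λ i → (toℕ i % 2 ≡ 1) × (col i ≡ j)) x) →
       InConv F p (λ i → toℕ i % 2 ≡ 0) x
lemma4 F d _ p homogeneous x (col , x∈Qⱼ) =
  odd-hulls⇒even-hull F {N = (d / 2 + 1 ∸ 1) * (d + 1) + 1} (d+2≤2[d/2+1]+1 d) p homogeneous x col x∈Qⱼ
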